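{- Let $m\geq 2$, $r$ and $k$ be positive integers, and let $\Delta:[1,g(m,r)-k]\to[1,r]$ be an $r$-coloring. Let $a=\min_{c}\, int_m(\Delta^{ -1}(c))$, the minimum over those colors $c\in[1,r]$ whose color class $\Delta^{ -1}(c)$ has at least $m$ elements (assume such a color exists). For each $c\in[1,r]$ let $A_c(\Delta)=|\Delta^{ -1}(c)\cap[1,a-1]|$ and $B_c(\Delta)=|\Delta^{ -1}(c)\cap[a+1,g(m,r)-k]|$. If $$\sum_{c\in[1,r]}\Big(A_c(\Delta)+\min\{B_c(\Delta),m-1\}\Big)\leq r(2m-2)-k,$$ then $\Delta$ is not an $L(r)$-coloring (with respect to $m$).
   Context: For integers $a,b$, $[a,b]$ denotes the set of integers $i$ with $a\le i\le b$. For a finite set $Z$ of integers, $int_m(Z)$ denotes the $m$-th smallest element of $Z$. For positive integers $m$ and $r$, $g(m,r)$ denotes the least positive integer $N$ such that for every map $\Delta:[1,N]\to[1,r]$ there exist $2m$ integers $x_1<\cdots<x_m<y_1<\cdots<y_m$ in $[1,N]$ with $\Delta(x_1)=\cdots=\Delta(x_m)$, $\Delta(y_1)=\cdots=\Delta(y_m)$, and $2(x_m-x_1)\leq y_m-x_1$. An $m$-set $Z=(z_1,\ldots,z_m)$ is a set of $m$ positive integers listed increasingly. For $m$-sets $X,Y$, write $X\prec Y$ if $x_m<y_1$. A set is monochromatic under $\Delta$ if $\Delta$ is constant on it. An $r$-coloring $\Delta:S\to[1,r]$ of a nonempty set $S$ of integers is an $L(r)$-coloring if there do not exist monochromatic $m$-sets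 $X,Y\subset S$ with $X\prec Y$ and $2(x_m-x_1)\leq y_m-x_1$. -}

module Defs where

open import Data.Nat using (ℕ; zero; suc; _+_; _*_; _∸_; _≤_; _<_)
open import Data.Nat.Properties using (_≟_)
open import Data.Product using (Σ; _×_; ∃-syntax)
open import Relation.Nullary using (¬_; yes; no)
open import Relation.Binary.PropositionalEquality using (_≡_)

-- A coloring is a function Δ : ℕ → ℕ; only its values on [1,N] matter.
-- "Δ is an r-coloring of [1,N]": every i ∈ [1,N] gets a color in [1,r].
IsColoring : (N r : ℕ) → (ℕ → ℕ) → Set
IsColoring N r Δ = ∀ i → 1 ≤ i → i ≤ N → (1 ≤ Δ i) × (Δ i ≤ r)

-- An m-set in [1,N] is given as x : ℕ → ℕ with x 0 < x 1 < … < x (m ∸ 1),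
-- all in [1,N]; x_1 = x 0 and x_m = x (m ∸ 1).
IsMSetIn : (m N : ℕ) → (ℕ → ℕ) → Set
IsMSetIn m N x =
  (∀ i → i < m → (1 ≤ x i) × (x i ≤ N)) ×
  (∀ i → suc i < m → x i < x (suc i))

Monochromatic : (m : ℕ) → (ℕ → ℕ) → (ℕ → ℕ) → Set
Monochromatic m Δ x = ∀ i → i < m → Δ (x i) ≡ Δ (x 0)

HasPattern : (m N : ℕ) → (ℕ → ℕ) → Set
HasPattern m N Δ =
  ∃[ x ] ∃[ y ]
    IsMSetIn m N x × IsMSetIn m N y ×
    Monochromatic m Δ x × Monochromatic m Δ y ×
    (x (m ∸ 1) < y 0) ×
    (2 * (x (m ∸ 1) ∸ x 0) ≤ y (m ∸ 1) ∸ x 0)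

IsLColoring : (m N : ℕ) → (ℕ → ℕ) → Set
IsLColoring m N Δ = ¬ HasPattern m N Δ

Forces : (m r N : ℕ) → Set
Forces m r N = ∀ (Δ : ℕ → ℕ) → IsColoring N r Δ → HasPattern m N Δ

IsG : (m r G : ℕ) → Set
IsG m r G = (1 ≤ G) × Forces m r G × (∀ N → 1 ≤ N → Forces m r N → G ≤ N)

cnt : (ℕ → ℕ) → ℕ → ℕ → ℕ
cnt Δ c zero = 0
cnt Δ c (suc t) with Δ (suc t) ≟ c
... | yes _ = cnt Δ c t + 1
... | no _  = cnt Δ c t

-- z = int_m(Δ⁻¹(c)) where Δ is a coloring of [1,N]
IsIntM : (m N : ℕ) → (ℕ → ℕ) → (c z : ℕ) → Set
IsIntM m N Δ c z = (1 ≤ z) × (z ≤ N) × (Δ z ≡ c) × (cnt Δ c z ≡ m)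

IsA : (m r N : ℕ) → (ℕ → ℕ) → ℕ → Set
IsA m r N Δ a =
  (∃[ c ] (1 ≤ c) × (c ≤ r) × (m ≤ cnt Δ c N) × IsIntM m N Δ c a) ×
  (∀ c z → 1 ≤ c → c ≤ r → m ≤ cnt Δ c N → IsIntM m N Δ c z → a ≤ z)

Acount : (ℕ → ℕ) → ℕ → ℕ → ℕ
Acount Δ a c = cnt Δ c (a ∸ 1)

Bcount : (ℕ → ℕ) → ℕ → ℕ → ℕ → ℕ
Bcount Δ N a c = cnt Δ c N ∸ cnt Δ c a

sumColors : ℕ → (ℕ → ℕ) → ℕ
sumColors zero f = 0
sumColors (suc r) f = sumColors r f + f (suc r)

-- Suppose Δ is an L(r)-coloring of [1, N], N = g(m,r) − k. We extend it point by point to an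
-- L(r)-coloring of [1, g(m,r)], which is absurd. The invariant is that no color occurs m times
-- before the anchor a while some color occurs m times up to a. Call W = Σ_c (A_c + min(B_c, m−1))
-- the weight; if W < r(2m−2), some color d has A_d < m−1 or B_d < m−1. In the first case put d in
-- front: the anchor moves to a + 1, and a new pattern would begin at 1 with its first block ending
-- after a + 1, so it could be rebuilt from the first m occurrences of the color realizing a. In the
-- second case append d at N + 1: a new pattern would end there, forcing m occurrences of d after a.
-- Either way W grows by at most one, so the budget W + k ≤ r(2m−2) lasts for k steps.

module Submission where

open import Defs
open import Data.Nat
  using (ℕ; zero; suc; pred; _+_; _*_; _∸_; _≤_; _≰_; _<_; _⊓_; z≤n; s≤s; s≤s⁻¹; z<s; _≤?_; >-nonZero)
open import Data.Nat.Properties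
open import Algebra.Properties.CommutativeSemigroup +-commutativeSemigroup
  using (interchange; xy∙z≈xz∙y)
open import Data.Product using (_×_; _,_; proj₁; proj₂; ∃-syntax)
open import Data.Sum using (_⊎_; inj₁; inj₂)
open import Function using (_∘_)
open import Relation.Nullary using (¬_; Dec; yes; no; contradiction)
open import Relation.Binary.PropositionalEquality

indicator : ℕ → ℕ → ℕ
indicator d c with d ≟ c
... | yes _ = 1
... | no  _ = 0

indicator-≡ : ∀ {d c} → d ≡ c → indicator d c ≡ 1
indicator-≡ {d} {c} d≡c with d ≟ c
... | yes _   = refl
... | no  d≢c = contradiction d≡c d≢c

indicator-≢ : ∀ {d c} → d ≢ c → indicator d c ≡ 0
indicator-≢ {d} {c} d≢c with d ≟ c
... | yes d≡c = contradiction d≡c d≢c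
... | no  _   = refl

cnt-suc : ∀ Δ c t → cnt Δ c (suc t) ≡ cnt Δ c t + indicator (Δ (suc t)) c
cnt-suc Δ c t with Δ (suc t) ≟ c
... | yes _ = refl
... | no  _ = sym (+-identityʳ _)

cnt-suc-≡ : ∀ Δ {c} t → Δ (suc t) ≡ c → cnt Δ c (suc t) ≡ suc (cnt Δ c t)
cnt-suc-≡ Δ {c} t e = begin
  cnt Δ c (suc t)                          ≡⟨ cnt-suc Δ c t ⟩
  cnt Δ c t + indicator (Δ (suc t)) c      ≡⟨ cong (cnt Δ c t +_) (indicator-≡ e) ⟩
  cnt Δ c t + 1                            ≡⟨ +-comm (cnt Δ c t) 1 ⟩
  suc (cnt Δ c t)                          ∎
  where open ≡-Reasoning

cnt-suc-≢ : ∀ Δ {c} t → Δ (suc t) ≢ c → cnt Δ c (suc t) ≡ cnt Δ c t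
cnt-suc-≢ Δ {c} t ne = begin
  cnt Δ c (suc t)                          ≡⟨ cnt-suc Δ c t ⟩
  cnt Δ c t + indicator (Δ (suc t)) c      ≡⟨ cong (cnt Δ c t +_) (indicator-≢ ne) ⟩
  cnt Δ c t + 0                            ≡⟨ +-identityʳ _ ⟩
  cnt Δ c t                                ∎
  where open ≡-Reasoning

cnt-≤-suc : ∀ Δ c t → cnt Δ c t ≤ cnt Δ c (suc t)
cnt-≤-suc Δ c t = ≤-trans (m≤m+n _ _) (≤-reflexive (sym (cnt-suc Δ c t)))

cnt-mono : ∀ Δ c {s t} → s ≤ t → cnt Δ c s ≤ cnt Δ c t
cnt-mono Δ c {t = zero} z≤n = ≤-refl
cnt-mono Δ c {t = suc t} s≤1+t with m≤n⇒m<n∨m≡n s≤1+t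
... | inj₁ s<1+t = ≤-trans (cnt-mono Δ c (s≤s⁻¹ s<1+t)) (cnt-≤-suc Δ c t)
... | inj₂ refl  = ≤-refl

cnt-<⇒< : ∀ Δ c {s t} → cnt Δ c s < cnt Δ c t → s < t
cnt-<⇒< Δ c lt = ≰⇒> (λ t≤s → <⇒≱ lt (cnt-mono Δ c t≤s))

cnt-cong : ∀ {Δ Δ′} c t → (∀ i → 1 ≤ i → i ≤ t → Δ i ≡ Δ′ i) → cnt Δ c t ≡ cnt Δ′ c t
cnt-cong c zero    _  = refl
cnt-cong {Δ} {Δ′} c (suc t) eq = begin
  cnt Δ c (suc t)                          ≡⟨ cnt-suc Δ c t ⟩
  cnt Δ c t + indicator (Δ (suc t)) c      ≡⟨ cong₂ (λ u e → u + indicator e c) IH (eq (suc t) (s≤s z≤n) ≤-refl) ⟩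
  cnt Δ′ c t + indicator (Δ′ (suc t)) c    ≡⟨ sym (cnt-suc Δ′ c t) ⟩
  cnt Δ′ c (suc t)                         ∎
  where
  open ≡-Reasoning
  IH = cnt-cong c t (λ i 1≤i i≤t → eq i 1≤i (m≤n⇒m≤1+n i≤t))

cnt-jump : ∀ Δ {c s t} → s < t → Δ t ≡ c → suc (cnt Δ c s) ≤ cnt Δ c t
cnt-jump Δ {t = suc t} (s≤s s≤t) e =
  ≤-trans (s≤s (cnt-mono Δ _ s≤t)) (≤-reflexive (sym (cnt-suc-≡ Δ t e)))

occurrence : (ℕ → ℕ) → ℕ → ℕ → ℕ → ℕ
occurrence Δ c j zero = zero
occurrence Δ c j (suc T) with j ≤? cnt Δ c T
... | yes _ = occurrence Δ c j T
... | no  _ = suc T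

occurrence-isIntM : ∀ Δ c j T → 1 ≤ j → j ≤ cnt Δ c T → IsIntM j T Δ c (occurrence Δ c j T)
occurrence-isIntM Δ c j zero 1≤j j≤0 = contradiction (≤-trans 1≤j j≤0) λ ()
occurrence-isIntM Δ c j (suc T) 1≤j j≤ with j ≤? cnt Δ c T
... | yes j≤cntT =
  let (1≤z , z≤T , Δz , cntz) = occurrence-isIntM Δ c j T 1≤j j≤cntT
  in 1≤z , m≤n⇒m≤1+n z≤T , Δz , cntz
... | no  j≰cntT = at-suc-T (Δ (suc T) ≟ c)
  where
  at-suc-T : Dec (Δ (suc T) ≡ c) → IsIntM j (suc T) Δ c (suc T)
  at-suc-T (yes Δ≡c) = s≤s z≤n , ≤-refl , Δ≡c ,
    ≤-antisym (≤-trans (≤-reflexive (cnt-suc-≡ Δ T Δ≡c)) (≰⇒> j≰cntT)) j≤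
  at-suc-T (no  Δ≢c) = contradiction (≤-trans j≤ (≤-reflexive (cnt-suc-≢ Δ T Δ≢c))) j≰cntT

mset-mono : ∀ {m} {x : ℕ → ℕ} → (∀ i → suc i < m → x i < x (suc i)) →
  ∀ {i j} → i ≤ j → j < m → x i ≤ x j
mset-mono inc {j = zero} z≤n _ = ≤-refl
mset-mono inc {i} {suc j} i≤1+j 1+j<m with m≤n⇒m<n∨m≡n i≤1+j
... | inj₁ i<1+j = ≤-trans (mset-mono inc (s≤s⁻¹ i<1+j) (<-trans (n<1+n j) 1+j<m))
                           (<⇒≤ (inc j 1+j<m))
... | inj₂ refl  = ≤-refl

mset-cnt : ∀ {m} Δ {x lo} → (∀ i → suc i < m → x i < x (suc i)) → Monochromatic m Δ x →
  lo < x 0 → ∀ i → i < m → suc i + cnt Δ (Δ (x 0)) lo ≤ cnt Δ (Δ (x 0)) (x i)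
mset-cnt Δ inc mono lo<x₀ zero    0<m   = cnt-jump Δ lo<x₀ (mono 0 0<m)
mset-cnt Δ inc mono lo<x₀ (suc i) 1+i<m =
  ≤-trans (s≤s (mset-cnt Δ inc mono lo<x₀ i (<-trans (n<1+n i) 1+i<m)))
          (cnt-jump Δ (inc i 1+i<m) (mono (suc i) 1+i<m))

occurrences-mset : ∀ Δ c j T → j ≤ cnt Δ c T →
  IsMSetIn j T (λ i → occurrence Δ c (suc i) T) × Monochromatic j Δ (λ i → occurrence Δ c (suc i) T)
occurrences-mset Δ c j T j≤ = (range , increasing) , monochromatic
  where
  x : ℕ → ℕ
  x i = occurrence Δ c (suc i) T
  spec : ∀ i → i < j → IsIntM (suc i) T Δ c (x i)
  spec i i<j = occurrence-isIntM Δ c (suc i) T (s≤s z≤n) (≤-trans i<j j≤)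
  range : ∀ i → i < j → (1 ≤ x i) × (x i ≤ T)
  range i i<j = let (1≤xᵢ , xᵢ≤T , _) = spec i i<j in 1≤xᵢ , xᵢ≤T
  color-at : ∀ i → i < j → Δ (x i) ≡ c
  color-at i i<j = let (_ , _ , Δxᵢ≡c , _) = spec i i<j in Δxᵢ≡c
  cnt-at : ∀ i → i < j → cnt Δ c (x i) ≡ suc i
  cnt-at i i<j = let (_ , _ , _ , cnt≡) = spec i i<j in cnt≡
  increasing : ∀ i → suc i < j → x i < x (suc i)
  increasing i 1+i<j = cnt-<⇒< Δ c
    (subst₂ _<_ (sym (cnt-at i (<-trans (n<1+n i) 1+i<j))) (sym (cnt-at (suc i) 1+i<j)) (n<1+n (suc i)))
  monochromatic : Monochromatic j Δ x
  monochromatic i i<j = trans (color-at i i<j) (sym (color-at 0 (≤-<-trans z≤n i<j)))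

mset-widen : ∀ {m T N x} → T ≤ N → IsMSetIn m T x → IsMSetIn m N x
mset-widen T≤N (range , inc) = (λ i i<m → proj₁ (range i i<m) , ≤-trans (proj₂ (range i i<m)) T≤N) , inc

mset-narrow : ∀ {m M N x} → (∀ i → i < m → x i ≤ M) → IsMSetIn m N x → IsMSetIn m M x
mset-narrow ≤M (range , inc) = (λ i i<m → proj₁ (range i i<m) , ≤M i i<m) , inc

monochromatic-transport : ∀ {m} Δ′ Δ x → (∀ i → i < m → Δ′ (x i) ≡ Δ (x i)) →
  Monochromatic m Δ′ x → Monochromatic m Δ x
monochromatic-transport Δ′ Δ x eq mono i i<m =
  trans (sym (eq i i<m)) (trans (mono i i<m) (eq 0 (≤-<-trans z≤n i<m)))

prepend : ℕ → (ℕ → ℕ) → ℕ → ℕ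
prepend d Δ (suc (suc i)) = Δ (suc i)
prepend d Δ _             = d

prepend-suc : ∀ d Δ {i} → 1 ≤ i → prepend d Δ (suc i) ≡ Δ i
prepend-suc d Δ (s≤s z≤n) = refl

prepend-≥2 : ∀ d Δ {i} → 2 ≤ i → prepend d Δ i ≡ Δ (pred i)
prepend-≥2 d Δ (s≤s (s≤s z≤n)) = refl

prepend-coloring : ∀ {N r d Δ} → 1 ≤ d → d ≤ r → IsColoring N r Δ → IsColoring (suc N) r (prepend d Δ)
prepend-coloring 1≤d d≤r col (suc zero)    _ _         = 1≤d , d≤r
prepend-coloring 1≤d d≤r col (suc (suc i)) _ (s≤s i<N) = col (suc i) (s≤s z≤n) i<N

cnt-prepend : ∀ d Δ c t → cnt (prepend d Δ) c (suc t) ≡ cnt Δ c t + indicator d c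
cnt-prepend d Δ c zero    = cnt-suc (prepend d Δ) c 0
cnt-prepend d Δ c (suc t) = begin
  cnt (prepend d Δ) c (suc (suc t))                         ≡⟨ cnt-suc (prepend d Δ) c (suc t) ⟩
  cnt (prepend d Δ) c (suc t) + indicator (Δ (suc t)) c     ≡⟨ cong (_+ indicator (Δ (suc t)) c) (cnt-prepend d Δ c t) ⟩
  cnt Δ c t + indicator d c + indicator (Δ (suc t)) c       ≡⟨ xy∙z≈xz∙y (cnt Δ c t) _ _ ⟩
  cnt Δ c t + indicator (Δ (suc t)) c + indicator d c       ≡⟨ cong (_+ indicator d c) (sym (cnt-suc Δ c t)) ⟩
  cnt Δ c (suc t) + indicator d c                           ∎
  where open ≡-Reasoning

prepend-mset : ∀ {m T} d Δ {x} → IsMSetIn m T x → Monochromatic m Δ x →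
  IsMSetIn m (suc T) (suc ∘ x) × Monochromatic m (prepend d Δ) (suc ∘ x)
prepend-mset d Δ (range , inc) mono =
  ((λ i i<m → s≤s z≤n , s≤s (proj₂ (range i i<m))) , (λ i 1+i<m → s≤s (inc i 1+i<m))) ,
  (λ i i<m → trans (prepend-suc d Δ (proj₁ (range i i<m)))
               (trans (mono i i<m) (sym (prepend-suc d Δ (proj₁ (range 0 (≤-<-trans z≤n i<m)))))))

append : ℕ → ℕ → (ℕ → ℕ) → ℕ → ℕ
append N d Δ i with i ≤? N
... | yes _ = Δ i
... | no  _ = d

append-≤ : ∀ N d Δ {i} → i ≤ N → append N d Δ i ≡ Δ i
append-≤ N d Δ {i} i≤N with i ≤? N
... | yes _   = refl
... | no  i≰N = contradiction i≤N i≰N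

append-> : ∀ N d Δ {i} → i ≰ N → append N d Δ i ≡ d
append-> N d Δ {i} i≰N with i ≤? N
... | yes i≤N = contradiction i≤N i≰N
... | no  _   = refl

append-coloring : ∀ {N r d Δ} → 1 ≤ d → d ≤ r → IsColoring N r Δ → IsColoring (suc N) r (append N d Δ)
append-coloring {N} 1≤d d≤r col i 1≤i _ with i ≤? N
... | yes i≤N = col i 1≤i i≤N
... | no  _   = 1≤d , d≤r

cnt-append-≤ : ∀ N d Δ c {t} → t ≤ N → cnt (append N d Δ) c t ≡ cnt Δ c t
cnt-append-≤ N d Δ c {t} t≤N = cnt-cong c t λ i _ i≤t → append-≤ N d Δ (≤-trans i≤t t≤N)

cnt-append-suc : ∀ N d Δ c → cnt (append N d Δ) c (suc N) ≡ cnt Δ c N + indicator d c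
cnt-append-suc N d Δ c = begin
  cnt (append N d Δ) c (suc N)                               ≡⟨ cnt-suc (append N d Δ) c N ⟩
  cnt (append N d Δ) c N + indicator (append N d Δ (suc N)) c ≡⟨ cong₂ _+_ (cnt-append-≤ N d Δ c ≤-refl)
                                                                   (cong (λ e → indicator e c) (append-> N d Δ 1+n≰n)) ⟩
  cnt Δ c N + indicator d c                                  ∎
  where open ≡-Reasoning

IsPattern : (m N : ℕ) → (ℕ → ℕ) → (x y : ℕ → ℕ) → Set
IsPattern m N Δ x y =
  IsMSetIn m N x × IsMSetIn m N y ×
  Monochromatic m Δ x × Monochromatic m Δ y ×
  (x (m ∸ 1) < y 0) ×
  (2 * (x (m ∸ 1) ∸ x 0) ≤ y (m ∸ 1) ∸ x 0)

twice-∸ : ∀ {p q} → q ≤ p → 2 * (p ∸ q) + 2 * q ≡ 2 * p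
twice-∸ {p} {q} q≤p = trans (sym (*-distribˡ-+ 2 (p ∸ q) q)) (cong (2 *_) (m∸n+n≡m q≤p))

∸-+-twice : ∀ {t q} → q ≤ t → (t ∸ q) + 2 * q ≡ t + q
∸-+-twice {t} {q} q≤t = begin
  (t ∸ q) + (q + (q + 0))    ≡⟨ cong (λ u → (t ∸ q) + (q + u)) (+-identityʳ q) ⟩
  (t ∸ q) + (q + q)          ≡⟨ sym (+-assoc (t ∸ q) q q) ⟩
  (t ∸ q) + q + q            ≡⟨ cong (_+ q) (m∸n+n≡m q≤t) ⟩
  t + q                      ∎
  where open ≡-Reasoning

-- Once x₁ ≤ x_m and x₁ ≤ y_m, the condition 2(x_m − x₁) ≤ y_m − x₁ says 2x_m ≤ y_m + x₁,
-- which is free of truncated subtraction.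
gap⇒sum : ∀ {p q t} → q ≤ p → q ≤ t → 2 * (p ∸ q) ≤ t ∸ q → 2 * p ≤ t + q
gap⇒sum {p} {q} {t} q≤p q≤t gap = begin
  2 * p                      ≡⟨ sym (twice-∸ q≤p) ⟩
  2 * (p ∸ q) + 2 * q        ≤⟨ +-monoˡ-≤ (2 * q) gap ⟩
  (t ∸ q) + 2 * q            ≡⟨ ∸-+-twice q≤t ⟩
  t + q                      ∎
  where open ≤-Reasoning

sum⇒gap : ∀ {p q t} → q ≤ p → q ≤ t → 2 * p ≤ t + q → 2 * (p ∸ q) ≤ t ∸ q
sum⇒gap {p} {q} {t} q≤p q≤t sum = +-cancelʳ-≤ (2 * q) _ _ (begin
  2 * (p ∸ q) + 2 * q        ≡⟨ twice-∸ q≤p ⟩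
  2 * p                      ≤⟨ sum ⟩
  t + q                      ≡⟨ sym (∸-+-twice q≤t) ⟩
  (t ∸ q) + 2 * q            ∎)
  where open ≤-Reasoning

twice-pred : ∀ {p q t} → 1 ≤ p → 1 ≤ q → 1 ≤ t → 2 * p ≤ t + q → 2 * pred p ≤ pred t + pred q
twice-pred {suc p} {suc q} {suc t} _ _ _ sum =
  s≤s⁻¹ (s≤s⁻¹ (subst₂ _≤_ (*-suc 2 p) (cong suc (+-suc t q)) sum))

mset-pred : ∀ {m N x} → (∀ i → i < m → 2 ≤ x i) → IsMSetIn m (suc N) x → IsMSetIn m N (pred ∘ x)
mset-pred 2≤ (range , inc) =
  (λ i i<m → pred-mono-≤ (2≤ i i<m) , pred-mono-≤ (proj₂ (range i i<m))) ,
  (λ i 1+i<m → pred-mono-< {{>-nonZero (proj₁ (range i (<-trans (n<1+n i) 1+i<m)))}} (inc i 1+i<m))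

-- From here on m = suc n, so the last element x (m ∸ 1) of an m-set x is x n.
module _ {n : ℕ} where

  first≤last : ∀ {N x} → IsMSetIn (suc n) N x → ∀ {i} → i < suc n → x 0 ≤ x i × x i ≤ x n
  first≤last (_ , inc) i<m = mset-mono inc z≤n i<m , mset-mono inc (s≤s⁻¹ i<m) (n<1+n n)

  mset-last-beyond : ∀ {N T} Δ {x} → IsMSetIn (suc n) N x → Monochromatic (suc n) Δ x →
    cnt Δ (Δ (x 0)) T ≤ n → T < x n
  mset-last-beyond {T = T} Δ {x} (range , inc) mono few = ≰⇒> λ xₙ≤T → 1+n≰n (begin
    suc n                          ≡⟨ sym (+-identityʳ (suc n)) ⟩
    suc n + cnt Δ (Δ (x 0)) 0      ≤⟨ mset-cnt Δ inc mono (proj₁ (range 0 (s≤s z≤n))) n (n<1+n n) ⟩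
    cnt Δ (Δ (x 0)) (x n)          ≤⟨ cnt-mono Δ _ xₙ≤T ⟩
    cnt Δ (Δ (x 0)) T              ≤⟨ few ⟩
    n                              ∎)
    where open ≤-Reasoning

  pattern-shrink-first : ∀ {N Δ x x′ y} → IsMSetIn (suc n) N x′ → Monochromatic (suc n) Δ x′ →
    x 0 ≤ x′ 0 → x′ n ≤ x n → IsPattern (suc n) N Δ x y → IsPattern (suc n) N Δ x′ y
  pattern-shrink-first {x = x} {x′} {y} x′set x′mono x₀≤x′₀ x′ₙ≤xₙ (xset , yset , _ , ymono , xₙ<y₀ , gap) =
    x′set , yset , x′mono , ymono , ≤-<-trans x′ₙ≤xₙ xₙ<y₀ ,
    sum⇒gap x′₀≤x′ₙ (≤-trans x′₀≤x′ₙ x′ₙ≤yₙ) (begin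
      2 * x′ n        ≤⟨ *-monoʳ-≤ 2 x′ₙ≤xₙ ⟩
      2 * x n         ≤⟨ gap⇒sum x₀≤xₙ (≤-trans x₀≤xₙ xₙ≤yₙ) gap ⟩
      y n + x 0       ≤⟨ +-monoʳ-≤ (y n) x₀≤x′₀ ⟩
      y n + x′ 0      ∎)
    where
    open ≤-Reasoning
    x₀≤xₙ  = proj₁ (first≤last xset (n<1+n n))
    x′₀≤x′ₙ = proj₁ (first≤last x′set (n<1+n n))
    xₙ≤yₙ  = ≤-trans (<⇒≤ xₙ<y₀) (proj₁ (first≤last yset (n<1+n n)))
    x′ₙ≤yₙ = ≤-trans x′ₙ≤xₙ xₙ≤yₙ

  pattern-unshift : ∀ {N d Δ x y} → 2 ≤ x 0 → IsPattern (suc n) (suc N) (prepend d Δ) x y →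
    IsPattern (suc n) N Δ (pred ∘ x) (pred ∘ y)
  pattern-unshift {d = d} {Δ} {x} {y} 2≤x₀ (xset , yset , xmono , ymono , xₙ<y₀ , gap) =
    mset-pred 2≤x xset , mset-pred 2≤y yset ,
    unshift-mono 2≤x xmono , unshift-mono 2≤y ymono ,
    pred-mono-< {{>-nonZero (positive (2≤x n (n<1+n n)))}} xₙ<y₀ ,
    sum⇒gap (pred-mono-≤ x₀≤xₙ) (pred-mono-≤ (≤-trans x₀≤xₙ xₙ≤yₙ))
      (twice-pred (positive (2≤x n (n<1+n n))) (positive 2≤x₀) (positive (2≤y n (n<1+n n)))
        (gap⇒sum x₀≤xₙ (≤-trans x₀≤xₙ xₙ≤yₙ) gap))
    where
    positive : ∀ {a} → 2 ≤ a → 1 ≤ a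
    positive = ≤-trans (n≤1+n 1)
    x₀≤xₙ = proj₁ (first≤last xset (n<1+n n))
    xₙ≤yₙ = ≤-trans (<⇒≤ xₙ<y₀) (proj₁ (first≤last yset (n<1+n n)))
    2≤x : ∀ i → i < suc n → 2 ≤ x i
    2≤x i i<m = ≤-trans 2≤x₀ (proj₁ (first≤last xset i<m))
    2≤y : ∀ i → i < suc n → 2 ≤ y i
    2≤y i i<m = ≤-trans 2≤x₀ (≤-trans x₀≤xₙ (≤-trans (<⇒≤ xₙ<y₀) (proj₁ (first≤last yset i<m))))
    unshift-mono : ∀ {z} → (∀ i → i < suc n → 2 ≤ z i) →
      Monochromatic (suc n) (prepend d Δ) z → Monochromatic (suc n) Δ (pred ∘ z)
    unshift-mono 2≤z mono i i<m =
      trans (sym (prepend-≥2 d Δ (2≤z i i<m))) (trans (mono i i<m) (prepend-≥2 d Δ (2≤z 0 (s≤s z≤n))))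

  pattern-restrict : ∀ {M N Δ Δ′ x y} → (∀ i → i ≤ M → Δ′ i ≡ Δ i) → y n ≤ M →
    IsPattern (suc n) N Δ′ x y → IsPattern (suc n) M Δ x y
  pattern-restrict {M} {Δ = Δ} {Δ′} {x} {y} eq yₙ≤M (xset , yset , xmono , ymono , xₙ<y₀ , gap) =
    mset-narrow x≤M xset , mset-narrow y≤M yset ,
    monochromatic-transport Δ′ Δ x (λ i i<m → eq (x i) (x≤M i i<m)) xmono ,
    monochromatic-transport Δ′ Δ y (λ i i<m → eq (y i) (y≤M i i<m)) ymono ,
    xₙ<y₀ , gap
    where
    y≤M : ∀ i → i < suc n → y i ≤ M
    y≤M i i<m = ≤-trans (proj₂ (first≤last yset i<m)) yₙ≤M
    x≤M : ∀ i → i < suc n → x i ≤ M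
    x≤M i i<m = ≤-trans (proj₂ (first≤last xset i<m)) (≤-trans (<⇒≤ xₙ<y₀) (y≤M 0 (s≤s z≤n)))

sumColors-+ : ∀ r f g → sumColors r (λ c → f c + g c) ≡ sumColors r f + sumColors r g
sumColors-+ zero    f g = refl
sumColors-+ (suc r) f g =
  trans (cong (_+ (f (suc r) + g (suc r))) (sumColors-+ r f g))
        (interchange (sumColors r f) (sumColors r g) (f (suc r)) (g (suc r)))

sumColors-mono : ∀ r {f g} → (∀ c → f c ≤ g c) → sumColors r f ≤ sumColors r g
sumColors-mono zero    _   = z≤n
sumColors-mono (suc r) f≤g = +-mono-≤ (sumColors-mono r f≤g) (f≤g (suc r))

sumColors-indicator-below : ∀ {d} r → r < d → sumColors r (indicator d) ≡ 0
sumColors-indicator-below zero    _   = refl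
sumColors-indicator-below (suc r) r<d =
  cong₂ _+_ (sumColors-indicator-below r (<-trans (n<1+n r) r<d)) (indicator-≢ λ d≡ → <-irrefl (sym d≡) r<d)

sumColors-indicator : ∀ d r → sumColors r (indicator d) ≤ 1
sumColors-indicator d zero = z≤n
sumColors-indicator d (suc r) with d ≟ suc r
... | yes refl = ≤-reflexive (cong (_+ 1) (sumColors-indicator-below r (n<1+n r)))
... | no  _    = ≤-trans (≤-reflexive (+-identityʳ _)) (sumColors-indicator d r)

sumColors-bump : ∀ r d {f g} → (∀ c → g c ≤ f c + indicator d c) → sumColors r g ≤ sumColors r f + 1
sumColors-bump r d {f} {g} g≤ = begin
  sumColors r g                                 ≤⟨ sumColors-mono r g≤ ⟩
  sumColors r (λ c → f c + indicator d c)       ≡⟨ sumColors-+ r f (indicator d) ⟩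
  sumColors r f + sumColors r (indicator d)     ≤⟨ +-monoʳ-≤ (sumColors r f) (sumColors-indicator d r) ⟩
  sumColors r f + 1                             ∎
  where open ≤-Reasoning

sumColors-large-or-light : ∀ r f b → r * b ≤ sumColors r f ⊎ ∃[ c ] (1 ≤ c) × (c ≤ r) × (f c < b)
sumColors-large-or-light zero f b = inj₁ z≤n
sumColors-large-or-light (suc r) f b with sumColors-large-or-light r f b | b ≤? f (suc r)
... | inj₂ (c , 1≤c , c≤r , light) | _ = inj₂ (c , 1≤c , m≤n⇒m≤1+n c≤r , light)
... | inj₁ large | yes b≤f = inj₁ (subst (_≤ sumColors (suc r) f) (+-comm (r * b) b) (+-mono-≤ large b≤f))
... | inj₁ _     | no  b≰f = inj₂ (suc r , s≤s z≤n , ≤-refl , ≰⇒> b≰f)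

module Extension (n r : ℕ) where

  colorWeight : ℕ → (ℕ → ℕ) → ℕ → ℕ → ℕ
  colorWeight N Δ a₀ c = Acount Δ (suc a₀) c + Bcount Δ N (suc a₀) c ⊓ n

  weight : ℕ → (ℕ → ℕ) → ℕ → ℕ
  weight N Δ a₀ = sumColors r (colorWeight N Δ a₀)

  -- The anchor suc a₀ plays the role of a.
  record Admissible (N : ℕ) (Δ : ℕ → ℕ) (a₀ : ℕ) : Set where
    field
      coloring : IsColoring N r Δ
      anchor≤N : suc a₀ ≤ N
      sparse   : ∀ c → 1 ≤ c → c ≤ r → cnt Δ c a₀ ≤ n
      full     : ∃[ c ] suc n ≤ cnt Δ c (suc a₀)
      avoids   : ¬ HasPattern (suc n) N Δ

  sparse-before-minimum : ∀ {N Δ a₀} → a₀ < N →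
    (∀ c z → 1 ≤ c → c ≤ r → suc n ≤ cnt Δ c N → IsIntM (suc n) N Δ c z → suc a₀ ≤ z) →
    ∀ c → 1 ≤ c → c ≤ r → cnt Δ c a₀ ≤ n
  sparse-before-minimum {Δ = Δ} {a₀} a₀<N minimal c 1≤c c≤r = ≮⇒≥ λ n<cnt →
    let (1≤z , z≤a₀ , Δz≡c , cnt≡) = occurrence-isIntM Δ c (suc n) a₀ (s≤s z≤n) n<cnt
        a₀<z = minimal c _ 1≤c c≤r (≤-trans n<cnt (cnt-mono Δ c (<⇒≤ a₀<N)))
                 (1≤z , ≤-trans z≤a₀ (<⇒≤ a₀<N) , Δz≡c , cnt≡)
    in 1+n≰n (≤-trans a₀<z z≤a₀)

  beyond-sparse : ∀ {N T Δ x} → IsColoring N r Δ → (∀ c → 1 ≤ c → c ≤ r → cnt Δ c T ≤ n) →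
    IsMSetIn (suc n) N x → Monochromatic (suc n) Δ x → T < x n
  beyond-sparse {Δ = Δ} {x} coloring sparse xset mono =
    mset-last-beyond Δ xset mono (sparse (Δ (x 0)) 1≤c c≤r)
    where
    x₀∈ = proj₁ xset 0 (s≤s z≤n)
    1≤c = proj₁ (coloring (x 0) (proj₁ x₀∈) (proj₂ x₀∈))
    c≤r = proj₂ (coloring (x 0) (proj₁ x₀∈) (proj₂ x₀∈))

  prepend-admissible : ∀ {N Δ a₀ d} → 1 ≤ d → d ≤ r → cnt Δ d a₀ < n →
    Admissible N Δ a₀ → Admissible (suc N) (prepend d Δ) (suc a₀)
  prepend-admissible {N} {Δ} {a₀} {d} 1≤d d≤r d-scarce adm = record
    { coloring = coloring′ ; anchor≤N = s≤s anchor≤N ; sparse = sparse′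
    ; full = c , full′ ; avoids = avoids′ }
    where
    open Admissible adm
    c = proj₁ full
    coloring′ = prepend-coloring 1≤d d≤r coloring
    sparse′ : ∀ c → 1 ≤ c → c ≤ r → cnt (prepend d Δ) c (suc a₀) ≤ n
    sparse′ c 1≤c c≤r = subst (_≤ n) (sym (cnt-prepend d Δ c a₀)) (bound (d ≟ c))
      where
      bound : Dec (d ≡ c) → cnt Δ c a₀ + indicator d c ≤ n
      bound (yes refl) = subst (_≤ n) (sym (trans (cong (cnt Δ d a₀ +_) (indicator-≡ refl)) (+-comm _ 1))) d-scarce
      bound (no  d≢c)  = subst (_≤ n) (sym (trans (cong (cnt Δ c a₀ +_) (indicator-≢ d≢c)) (+-identityʳ _)))
                           (sparse c 1≤c c≤r)
    full′ : suc n ≤ cnt (prepend d Δ) c (suc (suc a₀))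
    full′ = ≤-trans (proj₂ full) (≤-trans (m≤m+n _ _) (≤-reflexive (sym (cnt-prepend d Δ c (suc a₀)))))
    occurrences = occurrences-mset Δ c (suc n) (suc a₀) (proj₂ full)
    occurrence-range = proj₁ (proj₁ occurrences)
    shifted = prepend-mset d Δ (proj₁ occurrences) (proj₂ occurrences)
    -- A new pattern must start at 1 and then, since its first block ends beyond a + 1, that block
    -- can be replaced by the first m occurrences of c, shifted, which avoid position 1.
    avoids′ : ¬ HasPattern (suc n) (suc N) (prepend d Δ)
    avoids′ (x , y , pat@(xset , _ , xmono , _)) with 2 ≤? x 0
    ... | yes 2≤x₀ = avoids (_ , _ , pattern-unshift {d = d} {Δ} 2≤x₀ pat)
    ... | no  2≰x₀ = avoids (_ , _ , pattern-unshift {d = d} {Δ} (s≤s (proj₁ (occurrence-range 0 (s≤s z≤n))))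
            (pattern-shrink-first {Δ = prepend d Δ} (mset-widen (s≤s anchor≤N) (proj₁ shifted)) (proj₂ shifted)
              (≤-trans (s≤s⁻¹ (≰⇒> 2≰x₀)) (s≤s z≤n))
              (≤-trans (s≤s (proj₂ (occurrence-range n (n<1+n n))))
                       (beyond-sparse coloring′ sparse′ xset xmono))
              pat))

  weight-prepend : ∀ N Δ a₀ d → weight (suc N) (prepend d Δ) (suc a₀) ≤ weight N Δ a₀ + 1
  weight-prepend N Δ a₀ d = sumColors-bump r d λ c → ≤-reflexive (begin
    cnt Δ′ c (suc a₀) + (cnt Δ′ c (suc N) ∸ cnt Δ′ c (suc (suc a₀))) ⊓ n
      ≡⟨ cong₂ (λ u v → u + v ⊓ n) (cnt-prepend d Δ c a₀)
           (cong₂ _∸_ (cnt-prepend d Δ c N) (cnt-prepend d Δ c (suc a₀))) ⟩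
    cnt Δ c a₀ + indicator d c + ((cnt Δ c N + indicator d c) ∸ (cnt Δ c (suc a₀) + indicator d c)) ⊓ n
      ≡⟨ cong (λ v → cnt Δ c a₀ + indicator d c + v ⊓ n) (begin
           (cnt Δ c N + indicator d c) ∸ (cnt Δ c (suc a₀) + indicator d c)
             ≡⟨ cong₂ _∸_ (+-comm (cnt Δ c N) _) (+-comm (cnt Δ c (suc a₀)) _) ⟩
           (indicator d c + cnt Δ c N) ∸ (indicator d c + cnt Δ c (suc a₀))
             ≡⟨ [m+n]∸[m+o]≡n∸o (indicator d c) _ _ ⟩
           cnt Δ c N ∸ cnt Δ c (suc a₀) ∎) ⟩
    cnt Δ c a₀ + indicator d c + (cnt Δ c N ∸ cnt Δ c (suc a₀)) ⊓ n
      ≡⟨ xy∙z≈xz∙y (cnt Δ c a₀) _ _ ⟩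
    colorWeight N Δ a₀ c + indicator d c ∎)
    where
    open ≡-Reasoning
    Δ′ = prepend d Δ

  append-admissible : ∀ {N Δ a₀ d} → 1 ≤ d → d ≤ r → Bcount Δ N (suc a₀) d < n →
    Admissible N Δ a₀ → Admissible (suc N) (append N d Δ) a₀
  append-admissible {N} {Δ} {a₀} {d} 1≤d d≤r d-scarce adm = record
    { coloring = coloring′ ; anchor≤N = m≤n⇒m≤1+n anchor≤N ; sparse = sparse′
    ; full = c , full′ ; avoids = avoids′ }
    where
    open Admissible adm
    c = proj₁ full
    Δ′ = append N d Δ
    coloring′ = append-coloring 1≤d d≤r coloring
    sparse′ : ∀ c → 1 ≤ c → c ≤ r → cnt Δ′ c a₀ ≤ n
    sparse′ c 1≤c c≤r = subst (_≤ n) (sym (cnt-append-≤ N d Δ c (<⇒≤ anchor≤N))) (sparse c 1≤c c≤r)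
    full′ : suc n ≤ cnt Δ′ c (suc a₀)
    full′ = subst (suc n ≤_) (sym (cnt-append-≤ N d Δ c anchor≤N)) (proj₂ full)
    -- A new pattern must end at N + 1, so its second block is d-colored and lies after a.
    avoids′ : ¬ HasPattern (suc n) (suc N) Δ′
    avoids′ (x , y , pat@(xset , yset , xmono , ymono , xₙ<y₀ , _)) with y n ≤? N
    ... | yes yₙ≤N = avoids (x , y , pattern-restrict (λ i → append-≤ N d Δ) yₙ≤N pat)
    ... | no  yₙ≰N = <⇒≱ d-scarce (m+n≤o⇒m≤o∸n n (s≤s⁻¹ (begin
        suc n + cnt Δ d (suc a₀)      ≡⟨ cong (suc n +_) (sym (cnt-append-≤ N d Δ d anchor≤N)) ⟩
        suc n + cnt Δ′ d (suc a₀)     ≡⟨ cong (λ e → suc n + cnt Δ′ e (suc a₀)) (sym y-color) ⟩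
        suc n + cnt Δ′ (Δ′ (y 0)) (suc a₀)
          ≤⟨ mset-cnt Δ′ (proj₂ yset) ymono (≤-<-trans (beyond-sparse coloring′ sparse′ xset xmono) xₙ<y₀) n (n<1+n n) ⟩
        cnt Δ′ (Δ′ (y 0)) (y n)       ≡⟨ cong₂ (cnt Δ′) y-color yₙ≡1+N ⟩
        cnt Δ′ d (suc N)              ≡⟨ cnt-append-suc N d Δ d ⟩
        cnt Δ d N + indicator d d     ≡⟨ cong (cnt Δ d N +_) (indicator-≡ refl) ⟩
        cnt Δ d N + 1                 ≡⟨ +-comm (cnt Δ d N) 1 ⟩
        suc (cnt Δ d N)               ∎)))
      where
      open ≤-Reasoning
      yₙ≡1+N : y n ≡ suc N
      yₙ≡1+N = ≤-antisym (proj₂ (proj₁ yset n (n<1+n n))) (≰⇒> yₙ≰N)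
      y-color : Δ′ (y 0) ≡ d
      y-color = trans (sym (ymono n (n<1+n n))) (append-> N d Δ yₙ≰N)

  weight-append : ∀ {N Δ a₀ d} → suc a₀ ≤ N → weight (suc N) (append N d Δ) a₀ ≤ weight N Δ a₀ + 1
  weight-append {N} {Δ} {a₀} {d} anchor≤N = sumColors-bump r d λ c → begin
    cnt Δ′ c a₀ + (cnt Δ′ c (suc N) ∸ cnt Δ′ c (suc a₀)) ⊓ n
      ≡⟨ cong₂ (λ u v → u + v ⊓ n) (cnt-append-≤ N d Δ c (<⇒≤ anchor≤N))
           (cong₂ _∸_ (cnt-append-suc N d Δ c) (cnt-append-≤ N d Δ c anchor≤N)) ⟩
    cnt Δ c a₀ + ((cnt Δ c N + indicator d c) ∸ cnt Δ c (suc a₀)) ⊓ n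
      ≡⟨ cong (λ v → cnt Δ c a₀ + v ⊓ n) (+-∸-comm (indicator d c) (cnt-mono Δ c anchor≤N)) ⟩
    cnt Δ c a₀ + (Bcount Δ N (suc a₀) c + indicator d c) ⊓ n
      ≤⟨ +-monoʳ-≤ (cnt Δ c a₀) (⊓-monoʳ-≤ _ (m≤m+n n (indicator d c))) ⟩
    cnt Δ c a₀ + (Bcount Δ N (suc a₀) c + indicator d c) ⊓ (n + indicator d c)
      ≡⟨ cong (cnt Δ c a₀ +_) (sym (+-distribʳ-⊓ (indicator d c) _ n)) ⟩
    cnt Δ c a₀ + (Bcount Δ N (suc a₀) c ⊓ n + indicator d c)
      ≡⟨ sym (+-assoc (cnt Δ c a₀) _ _) ⟩
    colorWeight N Δ a₀ c + indicator d c ∎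
    where
    open ≤-Reasoning
    Δ′ = append N d Δ

  scarce-side : ∀ {A B} → A + B ⊓ n < n + n → A < n ⊎ B < n
  scarce-side {A} {B} light with n ≤? A | n ≤? B
  ... | no  n≰A | _       = inj₁ (≰⇒> n≰A)
  ... | yes _   | no  n≰B = inj₂ (≰⇒> n≰B)
  ... | yes n≤A | yes n≤B = contradiction (+-mono-≤ n≤A (≤-reflexive (sym (m≥n⇒m⊓n≡n n≤B)))) (<⇒≱ light)

  extend-by-one : ∀ {N Δ a₀} → Admissible N Δ a₀ → weight N Δ a₀ < r * (n + n) →
    ∃[ Δ′ ] ∃[ a₀′ ] Admissible (suc N) Δ′ a₀′ × weight (suc N) Δ′ a₀′ ≤ weight N Δ a₀ + 1
  extend-by-one {N} {Δ} {a₀} adm light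
    with sumColors-large-or-light r (colorWeight N Δ a₀) (n + n)
  ... | inj₁ heavy = contradiction heavy (<⇒≱ light)
  ... | inj₂ (d , 1≤d , d≤r , d-light) with scarce-side d-light
  ...   | inj₁ A<n = prepend d Δ , suc a₀ , prepend-admissible 1≤d d≤r A<n adm , weight-prepend N Δ a₀ d
  ...   | inj₂ B<n = append N d Δ , a₀ , append-admissible 1≤d d≤r B<n adm ,
                     weight-append (Admissible.anchor≤N adm)

  extend : ∀ k {N Δ a₀} → Admissible N Δ a₀ → weight N Δ a₀ + k ≤ r * (n + n) →
    ¬ Forces (suc n) r (k + N)
  extend zero    adm _ forces = Admissible.avoids adm (forces _ (Admissible.coloring adm))
  extend (suc k) {N} {Δ} {a₀} adm budget
    with extend-by-one adm (<-≤-trans (m<m+n (weight N Δ a₀) z<s) budget)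
  ... | Δ′ , a₀′ , adm′ , step = subst (λ M → ¬ Forces (suc n) r M) (+-suc k N)
          (extend k adm′ (≤-trans (+-monoˡ-≤ k step) (≤-trans (≤-reflexive (+-assoc _ 1 k)) budget)))

twice-suc∸2 : ∀ n → 2 * suc n ∸ 2 ≡ n + n
twice-suc∸2 n = trans (cong (_∸ 1) (+-suc n (n + 0))) (cong (n +_) (+-identityʳ n))

lemma4p2 : (m r k G : ℕ) → 2 ≤ m → 1 ≤ r → 1 ≤ k → IsG m r G →
    (Δ : ℕ → ℕ) → IsColoring (G ∸ k) r Δ →
    (a : ℕ) → IsA m r (G ∸ k) Δ a →
    sumColors r (λ c → Acount Δ a c + (Bcount Δ (G ∸ k) a c ⊓ (m ∸ 1))) + k
    ≤ r * (2 * m ∸ 2) →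
    ¬ IsLColoring m (G ∸ k) Δ
lemma4p2 zero _ _ _ ()
lemma4p2 (suc n) r k G _ _ _ _ Δ _ zero ((_ , _ , _ , _ , () , _) , _)
lemma4p2 (suc n) r k G _ _ _ (_ , forces , _) Δ coloring (suc a₀)
         ((c , _ , _ , _ , _ , a≤N , _ , cnt≡m) , minimal) budget avoids =
  extend k admissible (subst (λ s → weight N Δ a₀ + k ≤ r * s) (twice-suc∸2 n) budget)
    (subst (Forces (suc n) r) (sym (m+[n∸m]≡n k≤G)) forces)
  where
  open Extension n r
  N = G ∸ k
  k≤G : k ≤ G
  k≤G = <⇒≤ (m∸n≢0⇒n<m λ N≡0 → contradiction (subst (suc a₀ ≤_) N≡0 a≤N) λ ())
  admissible : Admissible N Δ a₀
  admissible = record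
    { coloring = coloring ; anchor≤N = a≤N ; sparse = sparse-before-minimum a≤N minimal
    ; full = c , ≤-reflexive (sym cnt≡m) ; avoids = avoids }
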